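{- Let $w = w_1 \ldots w_n$ be a partial word of length $n$ over an alphabet $\Sigma$, let $\hat{w}$ be the full word obtained from $w$ by treating the hole symbol $\diamond$ as an ordinary letter, and let $\mathcal{T}$ be the set of transit positions of $w$. Assume we are given (1) a data structure answering in $O(1)$ time any query $\mathit{lcp}(i,j)$, the length of the longest common prefix of the suffixes of $\hat{w}$ starting at positions $i$ and $j$; and (2) a table storing $\mathit{lccp}(i,j)$ for all $i \in \{1,\ldots,n\}$ and $j \in \mathcal{T}$ (indexable symmetrically, i.e.\ also as $\mathit{lccp}(j,i)$). Then $\mathit{lccp}(i,j)$ can be computed in $O(1)$ time for any $1 \le i,j \le n$.
   Context: A partial word of length $n$ is $w = w_1\ldots w_n$ with each $w_i \in \Sigma \cup \{\diamond\}$, where $\diamond \notin \Sigma$ denotes a hole; a non-hole position is called solid. The compatibility relation $\uparrow$ on $\Sigma\cup\{\diamond\}$ is defined by $a \uparrow a$ for all symbols and $a \uparrow \diamond$, $\diamond \uparrow a$ for all $a \in \Sigma$; it is extended letter by letter to partial words of equal length. For a subword $w[i,j] = w_i\ldots w_j$, the longest common compatible prefix $\mathit{lccp}(i,j)$ is the largest $k$ such that $w[i,i+k-1] \uparrow w[j,j+k-1]$ (with all indices within $1,\ldots,n$); by convention $\mathit{lccp}(i,n+1)=\mathit{lccp}(n+1,i)=0$. Add a sentinel position $w_0$: $w_0=\diamond$ if $w_1$ is solid, and $w_0 = a$ for some $a\in\Sigma$ if $w_1$ is a hole. A position $i\in\{1,\ldots,n\}$ is transit if $w_i$ is a hole and $w_{i-1}$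 is solid, or $w_i$ is solid and $w_{i-1}$ is a hole. Computation is in the standard word-RAM model. -}

module Defs where

open import Data.Nat using (ℕ; zero; suc; _+_; _*_; _∸_; _≤_; _<_; _≤?_)
open import Data.Nat.Properties using ()
open import Data.Fin using (Fin)
open import Data.Vec using (Vec; lookup; _∷_)
open import Data.Maybe using (Maybe; just; nothing)
open import Data.Maybe.Properties using (≡-dec)
open import Data.Product using (Σ; ∃; _×_; _,_)
open import Data.Sum using (_⊎_)
open import Data.Unit using (⊤)
open import Relation.Nullary using (¬_; yes; no)
open import Relation.Binary.Definitions using (DecidableEquality)
open import Relation.Binary.PropositionalEquality using (_≡_)

-- A partial word of length n over alphabet A is given by a function
-- w : ℕ → Maybe A, where `nothing` is the hole ◇ and `just a` the
-- solid letter a.  Positions 1..n are the word; position 0 is the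
-- sentinel w₀; values at positions > n are irrelevant (unconstrained).

Hole : {A : Set} → Maybe A → Set
Hole x = x ≡ nothing

Solid : {A : Set} → Maybe A → Set
Solid {A} x = Σ A λ a → x ≡ just a

_↑_ : {A : Set} → Maybe A → Maybe A → Set
nothing ↑ _       = ⊤
just a  ↑ nothing = ⊤
just a  ↑ just b  = a ≡ b

-- w[i, i+k-1] ↑ w[j, j+k-1], all indices within 1..n (i, j ≥ 1 assumed
-- by callers; the upper bound is enforced here)
CompatPrefix : {A : Set} → ℕ → (ℕ → Maybe A) → ℕ → ℕ → ℕ → Set
CompatPrefix n w i j k =
  ∀ t → t < k → (i + t ≤ n × j + t ≤ n) × (w (i + t) ↑ w (j + t))

-- k is the longest common compatible prefix lccp(i,j): the largest k
-- with the compatible-prefix property (the property is prefix closed,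
-- so "largest" = holds for k and fails for k+1).
IsLccp : {A : Set} → ℕ → (ℕ → Maybe A) → ℕ → ℕ → ℕ → Set
IsLccp n w i j k = CompatPrefix n w i j k × ¬ CompatPrefix n w i j (suc k)

-- ŵ: the full word where ◇ is an ordinary letter; common prefixes of
-- suffixes of ŵ use plain equality of Maybe A values.
EqPrefix : {A : Set} → ℕ → (ℕ → Maybe A) → ℕ → ℕ → ℕ → Set
EqPrefix n w i j k =
  ∀ t → t < k → (i + t ≤ n × j + t ≤ n) × (w (i + t) ≡ w (j + t))

IsLcp : {A : Set} → ℕ → (ℕ → Maybe A) → ℕ → ℕ → ℕ → Set
IsLcp n w i j k = EqPrefix n w i j k × ¬ EqPrefix n w i j (suc k)

Sentinel : {A : Set} → (ℕ → Maybe A) → Set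
Sentinel w = (Solid (w 1) → Hole (w 0)) × (Hole (w 1) → Solid (w 0))

Transit : {A : Set} → ℕ → (ℕ → Maybe A) → ℕ → Set
Transit n w i =
  (1 ≤ i × i ≤ n) ×
  ((Hole (w i) × Solid (w (i ∸ 1))) ⊎ (Solid (w i) × Hole (w (i ∸ 1))))

-- Constant-time computation model (word-RAM with oracle access).
-- A program is a finite tree of unit-cost instructions over k registers
-- holding natural numbers.  Since a program is a fixed finite object,
-- independent of n, w, i, j, its running time (tree depth) is a constant,
-- i.e. O(1).

data Comp : ℕ → Set where
  ret    : ∀ {k} → Fin k → Comp k
  const  : ∀ {k} → ℕ → Comp (suc k) → Comp k
  add    : ∀ {k} → Fin k → Fin k → Comp (suc k) → Comp k
  sub    : ∀ {k} → Fin k → Fin k → Comp (suc k) → Comp k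
  mul    : ∀ {k} → Fin k → Fin k → Comp (suc k) → Comp k
  ifLe   : ∀ {k} → Fin k → Fin k → Comp k → Comp k → Comp k
  ifHole : ∀ {k} → Fin k → Comp k → Comp k → Comp k
  ifEqSym : ∀ {k} → Fin k → Fin k → Comp k → Comp k → Comp k
  lcpQ   : ∀ {k} → Fin k → Fin k → Comp (suc k) → Comp k
  tabQ   : ∀ {k} → Fin k → Fin k → Comp (suc k) → Comp k

-- Semantics, given the word, the lcp oracle and the lccp table
-- (modelled as functions; only their values on valid arguments are
-- constrained by the hypotheses of the theorem).
run : {A : Set} → DecidableEquality A → (ℕ → Maybe A) →
      (lcpO tabO : ℕ → ℕ → ℕ) → ∀ {k} → Comp k → Vec ℕ k → ℕ
run eq w lcpO tabO (ret r) ρ = lookup ρ r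
run eq w lcpO tabO (const c p) ρ = run eq w lcpO tabO p (c ∷ ρ)
run eq w lcpO tabO (add r s p) ρ = run eq w lcpO tabO p (lookup ρ r + lookup ρ s ∷ ρ)
run eq w lcpO tabO (sub r s p) ρ = run eq w lcpO tabO p (lookup ρ r ∸ lookup ρ s ∷ ρ)
run eq w lcpO tabO (mul r s p) ρ = run eq w lcpO tabO p (lookup ρ r * lookup ρ s ∷ ρ)
run eq w lcpO tabO (ifLe r s p q) ρ with lookup ρ r ≤? lookup ρ s
... | yes _ = run eq w lcpO tabO p ρ
... | no  _ = run eq w lcpO tabO q ρ
run eq w lcpO tabO (ifHole r p q) ρ with w (lookup ρ r)
... | nothing = run eq w lcpO tabO p ρ
... | just _  = run eq w lcpO tabO q ρ
run eq w lcpO tabO (ifEqSym r s p q) ρ with ≡-dec eq (w (lookup ρ r)) (w (lookup ρ s))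
... | yes _ = run eq w lcpO tabO p ρ
... | no  _ = run eq w lcpO tabO q ρ
run eq w lcpO tabO (lcpQ r s p) ρ = run eq w lcpO tabO p (lcpO (lookup ρ r) (lookup ρ s) ∷ ρ)
run eq w lcpO tabO (tabQ r s p) ρ = run eq w lcpO tabO p (tabO (lookup ρ r) (lookup ρ s) ∷ ρ)

module Submission where

open import Defs
open import Data.Nat using (ℕ; _≤_)
open import Data.Maybe using (Maybe)
open import Data.Vec using (_∷_; [])
open import Data.Product using (Σ; _×_)
open import Relation.Binary.Definitions using (DecidableEquality)

open import Data.Nat using (zero; suc; _+_; _∸_; _<_; _≤?_; z≤n; s≤s; z<s)
open import Data.Nat.Properties
open import Data.Maybe using (just; nothing)
open import Data.Fin using (Fin) renaming (zero to r₀; suc to ↑r)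
open import Data.Vec using (Vec; lookup)
open import Data.Product using (_,_; proj₁; proj₂)
open import Data.Sum using (inj₁; inj₂)
open import Data.Empty using (⊥-elim)
open import Data.Unit using (tt)
open import Function using (_∘_)
open import Relation.Nullary using (¬_; yes; no)
open import Relation.Binary.PropositionalEquality

-- Let k = lcp(i,j) in ŵ.  Equal letters are compatible, so
-- the first k positions are a compatible prefix, and lccp is additive:
-- lccp(i,j) = k + lccp(i+k, j+k).  If the suffixes end or the letters at
-- i+k, j+k are distinct solid letters, the lccp is k.  Otherwise one of
-- them, say p, is a hole.  If w_{p-1} is solid then p is a transit
-- position and the table answers.  If w_{p-1} is a hole (so p ≥ 2 by the
-- sentinel), r = lcp(p-1, p) measures the run of holes w_{p-1} … w_{p+r-1};
-- these holes match anything, so either the other suffix ends inside the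
-- run, or the run reaches the end of the word, or p+r is a transit
-- position and lccp(p,q) = r + lccp(p+r, q+r) is read from the table.

↑-refl : {A : Set} (x : Maybe A) → x ↑ x
↑-refl nothing  = tt
↑-refl (just _) = refl

↑-sym : {A : Set} (x y : Maybe A) → x ↑ y → y ↑ x
↑-sym nothing  nothing  _   = tt
↑-sym nothing  (just _) _   = tt
↑-sym (just _) nothing  _   = tt
↑-sym (just _) (just _) a≡b = sym a≡b

hole-↑ : {A : Set} {x : Maybe A} (y : Maybe A) → Hole x → x ↑ y
hole-↑ y refl = tt

solid-↑⇒≡ : {A : Set} {x y : Maybe A} {a b : A} →
            x ≡ just a → y ≡ just b → x ↑ y → x ≡ y
solid-↑⇒≡ refl refl a≡b = cong just a≡b

≢-hole⇒solid : {A : Set} {x y : Maybe A} → Hole x → x ≢ y → Solid y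
≢-hole⇒solid {y = just b}  _    _   = b , refl
≢-hole⇒solid {y = nothing} refl x≢y = ⊥-elim (x≢y refl)

-- Positions x and y agree: both lie in the word and are compatible.
-- CompatPrefix n w i j k says exactly that i+t and j+t agree for t < k.
Agree : {A : Set} → ℕ → (ℕ → Maybe A) → ℕ → ℕ → Set
Agree n w x y = (x ≤ n × y ≤ n) × (w x ↑ w y)

prefix-append : (P : ℕ → Set) (k : ℕ) {L : ℕ} →
  (∀ t → t < k → P t) → (∀ s → s < L → P (k + s)) → ∀ t → t < k + L → P t
prefix-append P zero    below above t       t<L          = above t t<L
prefix-append P (suc k) below above zero    _            = below zero z<s
prefix-append P (suc k) below above (suc t) (s≤s t<k+L) =
  prefix-append (P ∘ suc) k (λ t t<k → below (suc t) (s≤s t<k)) above t t<k+L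

offset-bound : ∀ {q r n} → q + r ≤ n → ∀ t → t < r → q + t ≤ n
offset-bound {q} q+r≤n t t<r = ≤-trans (<⇒≤ (+-monoʳ-< q t<r)) q+r≤n

module Prefixes {A : Set} (n : ℕ) (w : ℕ → Maybe A) where

  compatPrefix-sym : ∀ {i j k} → CompatPrefix n w i j k → CompatPrefix n w j i k
  compatPrefix-sym {i} {j} C t t<k =
    let ((i+t≤n , j+t≤n) , c) = C t t<k
    in (j+t≤n , i+t≤n) , ↑-sym (w (i + t)) (w (j + t)) c

  lccp-sym : ∀ {i j k} → IsLccp n w i j k → IsLccp n w j i k
  lccp-sym (C , ¬C) = compatPrefix-sym C , ¬C ∘ compatPrefix-sym

  eqPrefix⇒compatPrefix : ∀ {i j k} → EqPrefix n w i j k → CompatPrefix n w i j k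
  eqPrefix⇒compatPrefix {i} E t t<k =
    let (bounds , e) = E t t<k
    in bounds , subst (w (i + t) ↑_) e (↑-refl (w (i + t)))

  lccp-stop : ∀ {i j k} → CompatPrefix n w i j k →
              ¬ Agree n w (i + k) (j + k) → IsLccp n w i j k
  lccp-stop {k = k} C ¬agree = C , λ C′ → ¬agree (C′ k (n<1+n k))

  lccp-shift : ∀ {i j k L} → CompatPrefix n w i j k →
               IsLccp n w (i + k) (j + k) L → IsLccp n w i j (k + L)
  lccp-shift {i} {j} {k} {L} C (C′ , ¬C′) = prefix , ¬longer
    where
    prefix : CompatPrefix n w i j (k + L)
    prefix = prefix-append (λ t → Agree n w (i + t) (j + t)) k C
      (λ s s<L → subst₂ (Agree n w) (+-assoc i k s) (+-assoc j k s) (C′ s s<L))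

    ¬longer : ¬ CompatPrefix n w i j (suc (k + L))
    ¬longer D = ¬C′ λ s s<1+L →
      subst₂ (Agree n w) (sym (+-assoc i k s)) (sym (+-assoc j k s))
        (D (k + s) (subst (k + s <_) (+-suc k L) (+-monoʳ-< k s<1+L)))

  lcp-mismatch : ∀ {i j k} → IsLcp n w i j k →
                 i + k ≤ n → j + k ≤ n → w (i + k) ≢ w (j + k)
  lcp-mismatch {k = k} (E , ¬E) i+k≤n j+k≤n e = ¬E extended
    where
    extended : EqPrefix n w _ _ (suc k)
    extended t t<1+k with m<1+n⇒m<n∨m≡n t<1+k
    ... | inj₁ t<k  = E t t<k
    ... | inj₂ refl = (i+k≤n , j+k≤n) , e

  holeRun : ∀ {p r} → Hole (w p) → EqPrefix n w p (suc p) r →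
            ∀ t → t ≤ r → Hole (w (p + t))
  holeRun {p} hole E zero    _      = subst (Hole ∘ w) (sym (+-identityʳ p)) hole
  holeRun {p} hole E (suc t) t<r =
    trans (cong w (+-suc p t))
      (trans (sym (proj₂ (E t t<r))) (holeRun hole E t (<⇒≤ t<r)))

  -- Inside a hole run every position is a hole, hence compatible with any
  -- in-word positions.
  holeRun-compat : ∀ {p′ q r} → Hole (w p′) → EqPrefix n w p′ (suc p′) r →
    ∀ m → m ≤ r → (∀ t → t < m → q + t ≤ n) → CompatPrefix n w (suc p′) q m
  holeRun-compat {p′} {q} hole E m m≤r qBound t t<m =
    (proj₂ (proj₁ (E t (<-≤-trans t<m m≤r))) , qBound t t<m) ,
    hole-↑ (w (q + t))
      (subst (Hole ∘ w) (+-suc p′ t) (holeRun hole E (suc t) (<-≤-trans t<m m≤r)))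

-- lccp(p, q) when w_{p-1} … w_{p+r-1} are holes: the other suffix ends
-- inside the run, or the run ends the word, or p+r is transit.
runCase : (tabO : ℕ → ℕ → ℕ) (n p q r : ℕ) → ℕ
runCase tabO n p q r with q + r ≤? n
... | no _ = suc n ∸ q
... | yes _ with p + r ≤? n
...   | yes _ = r + tabO (p + r) (q + r)
...   | no _  = r

-- lccp(p, q) when w_p is a hole.
holeCase : {A : Set} → (ℕ → Maybe A) → (lcpO tabO : ℕ → ℕ → ℕ) → (n p q : ℕ) → ℕ
holeCase w lcpO tabO n p q with w (p ∸ 1)
... | just _  = tabO p q
... | nothing = runCase tabO n p q (lcpO (p ∸ 1) p)

lccpFormula : {A : Set} → (ℕ → Maybe A) → (lcpO tabO : ℕ → ℕ → ℕ) → (n i j : ℕ) → ℕ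
lccpFormula w lcpO tabO n i j with i + lcpO i j ≤? n
... | no _ = lcpO i j
... | yes _ with j + lcpO i j ≤? n
...   | no _ = lcpO i j
...   | yes _ with w (i + lcpO i j)
...     | nothing = lcpO i j + holeCase w lcpO tabO n (i + lcpO i j) (j + lcpO i j)
...     | just _ with w (j + lcpO i j)
...       | nothing = lcpO i j + holeCase w lcpO tabO n (j + lcpO i j) (i + lcpO i j)
...       | just _  = lcpO i j

module Correctness {A : Set} (n : ℕ) (w : ℕ → Maybe A) (sen : Sentinel w)
  (lcpO : ℕ → ℕ → ℕ)
  (lcpH : ∀ i j → 1 ≤ i → i ≤ n → 1 ≤ j → j ≤ n → IsLcp n w i j (lcpO i j))
  (tabO : ℕ → ℕ → ℕ)
  (tabH : ∀ i j → 1 ≤ i → i ≤ n → Transit n w j →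
        IsLccp n w i j (tabO i j) × IsLccp n w j i (tabO j i)) where

  open Prefixes n w

  tab-transit : ∀ {p q} → 1 ≤ q → q ≤ n → Transit n w p → IsLccp n w p q (tabO p q)
  tab-transit 1≤q q≤n T = proj₂ (tabH _ _ 1≤q q≤n T)

  runCase-correct : ∀ p′ q r → Hole (w p′) → IsLcp n w p′ (suc p′) r →
    1 ≤ q → q ≤ n → IsLccp n w (suc p′) q (runCase tabO n (suc p′) q r)
  -- The three outcomes: q's suffix ends inside the run; the word ends right
  -- after the run; or p+r is transit and lccp is additive across the run.
  runCase-correct p′ q r hole L@(E , _) 1≤q q≤n with q + r ≤? n
  ... | no q+r≰n = lccp-stop (holeRun-compat hole E X X≤r qBound) λ agree →
          1+n≰n (subst (_≤ n) q+X≡1+n (proj₂ (proj₁ agree)))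
    where
    X : ℕ
    X = suc n ∸ q
    q+X≡1+n : q + X ≡ suc n
    q+X≡1+n = m+[n∸m]≡n (≤-trans q≤n (n≤1+n n))
    X≤r : X ≤ r
    X≤r = m≤n+o⇒m∸n≤o (suc n) q (≰⇒> q+r≰n)
    qBound : ∀ t → t < X → q + t ≤ n
    qBound t t<X = m<1+n⇒m≤n (subst (q + t <_) q+X≡1+n (+-monoʳ-< q t<X))
  ... | yes q+r≤n with suc p′ + r ≤? n
  ...   | no p+r≰n = lccp-stop (holeRun-compat hole E r ≤-refl (offset-bound q+r≤n)) (p+r≰n ∘ proj₁ ∘ proj₁)
  ...   | yes p+r≤n = lccp-shift (holeRun-compat hole E r ≤-refl (offset-bound q+r≤n))
                    (tab-transit 1≤q+r q+r≤n transit)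
    where
    1≤q+r : 1 ≤ q + r
    1≤q+r = ≤-trans 1≤q (m≤m+n q r)
    -- w_{p+r} is solid, as it differs from the hole w_{p'+r}.
    transit : Transit n w (suc p′ + r)
    transit = (s≤s z≤n , p+r≤n) ,
      inj₂ (≢-hole⇒solid (holeRun hole E r ≤-refl)
              (lcp-mismatch L (≤-trans (n≤1+n (p′ + r)) p+r≤n) p+r≤n) ,
            holeRun hole E r ≤-refl)

  -- By the sentinel, a hole at position 1 is preceded by a solid w₀;
  -- so a hole preceded by a hole is at position ≥ 2.
  double-hole-positive : ∀ p′ → Hole (w (suc p′)) → Hole (w p′) → 1 ≤ p′
  double-hole-positive zero    hole₁ hole₀ with proj₂ sen hole₁
  ... | _ , w₀≡just with trans (sym hole₀) w₀≡just
  ... | ()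
  double-hole-positive (suc _) _     _     = s≤s z≤n

  -- A hole at p is either transit (solid predecessor) or continues a run.
  holeCase-correct : ∀ p q → Hole (w p) → 1 ≤ p → p ≤ n → 1 ≤ q → q ≤ n →
                     IsLccp n w p q (holeCase w lcpO tabO n p q)
  holeCase-correct (suc p′) q hole (s≤s z≤n) p≤n 1≤q q≤n with w p′ in w-p′
  ... | just a  = tab-transit 1≤q q≤n ((s≤s z≤n , p≤n) , inj₁ (hole , a , w-p′))
  ... | nothing = runCase-correct p′ q _ w-p′
        (lcpH p′ (suc p′) (double-hole-positive p′ hole w-p′) (≤-trans (n≤1+n p′) p≤n) (s≤s z≤n) p≤n)
        1≤q q≤n

  module _ (i j : ℕ) (1≤i : 1 ≤ i) (i≤n : i ≤ n) (1≤j : 1 ≤ j) (j≤n : j ≤ n) where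

    lcp : IsLcp n w i j (lcpO i j)
    lcp = lcpH i j 1≤i i≤n 1≤j j≤n

    lcpPrefix : CompatPrefix n w i j (lcpO i j)
    lcpPrefix = eqPrefix⇒compatPrefix (proj₁ lcp)

    -- After the lcp k: stop at the word end or at two distinct solid
    -- letters; otherwise shift past k and resolve the hole.
    lccpFormula-correct : IsLccp n w i j (lccpFormula w lcpO tabO n i j)
    lccpFormula-correct with i + lcpO i j ≤? n
    ... | no i+k≰n = lccp-stop lcpPrefix (i+k≰n ∘ proj₁ ∘ proj₁)
    ... | yes i+k≤n with j + lcpO i j ≤? n
    ...   | no j+k≰n = lccp-stop lcpPrefix (j+k≰n ∘ proj₂ ∘ proj₁)
    ...   | yes j+k≤n with w (i + lcpO i j) in w-i+k
    ...     | nothing = lccp-shift lcpPrefix (holeCase-correct _ _ w-i+k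
                          (≤-trans 1≤i (m≤m+n i _)) i+k≤n (≤-trans 1≤j (m≤m+n j _)) j+k≤n)
    ...     | just _ with w (j + lcpO i j) in w-j+k
    ...       | nothing = lccp-shift lcpPrefix (lccp-sym (holeCase-correct _ _ w-j+k
                            (≤-trans 1≤j (m≤m+n j _)) j+k≤n (≤-trans 1≤i (m≤m+n i _)) i+k≤n))
    ...       | just _ = lccp-stop lcpPrefix λ (_ , c) →
                  lcp-mismatch lcp i+k≤n j+k≤n (solid-↑⇒≡ w-i+k w-j+k c)

-- With registers rn, rp, rq, rk holding n, p, q, k, return k + holeCase(p, q).
-- Each instruction pushes its result, shifting the older registers by one.
holeProg : ∀ {m} → (rn rp rq rk : Fin m) → Comp m
holeProg rn rp rq rk =
  const 1 (sub (↑r rp) r₀                                        -- p-1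
  (ifHole r₀                                                      -- w_{p-1} a hole?
    (lcpQ r₀ (↑r (↑r rp))                                         -- r = lcp(p-1, p)
    (add (↑r (↑r (↑r rq))) r₀                                     -- q + r
    (ifLe r₀ (↑r (↑r (↑r (↑r rn))))                               -- q + r ≤ n ?
      (add (↑r (↑r (↑r (↑r rp)))) (↑r r₀)                         -- p + r
      (ifLe r₀ (↑r (↑r (↑r (↑r (↑r rn)))))                        -- p + r ≤ n ?
        (tabQ r₀ (↑r r₀)                                          -- tab(p+r, q+r)
        (add (↑r (↑r (↑r r₀))) r₀                                 -- r + tab
        (add (↑r (↑r (↑r (↑r (↑r (↑r (↑r rk))))))) r₀ (ret r₀))))  -- k + r + tab
        (add (↑r (↑r (↑r (↑r (↑r rk))))) (↑r (↑r r₀)) (ret r₀))))  -- k + r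
      (const 1 (add r₀ (↑r (↑r (↑r (↑r (↑r rn)))))                -- 1 + n
      (sub r₀ (↑r (↑r (↑r (↑r (↑r (↑r rq))))))                    -- (1 + n) - q
      (add (↑r (↑r (↑r (↑r (↑r (↑r (↑r rk))))))) r₀ (ret r₀))))))))  -- k + (1 + n - q)
    (tabQ (↑r (↑r rp)) (↑r (↑r rq))                               -- tab(p, q)
    (add (↑r (↑r (↑r rk))) r₀ (ret r₀)))))                         -- k + tab

run-holeProg : {A : Set} (eq : DecidableEquality A) (w : ℕ → Maybe A) (lcpO tabO : ℕ → ℕ → ℕ) →
  ∀ {m} (rn rp rq rk : Fin m) (ρ : Vec ℕ m) →
  run eq w lcpO tabO (holeProg rn rp rq rk) ρ ≡
    lookup ρ rk + holeCase w lcpO tabO (lookup ρ rn) (lookup ρ rp) (lookup ρ rq)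
run-holeProg eq w lcpO tabO rn rp rq rk ρ with w (lookup ρ rp ∸ 1)
... | just _ = refl
... | nothing with lookup ρ rq + lcpO (lookup ρ rp ∸ 1) (lookup ρ rp) ≤? lookup ρ rn
...   | no _ = refl
...   | yes _ with lookup ρ rp + lcpO (lookup ρ rp ∸ 1) (lookup ρ rp) ≤? lookup ρ rn
...     | yes _ = refl
...     | no _  = refl

-- Registers start as n, i, j; compute k = lcp(i,j), i+k, j+k, then branch.
mainProg : Comp 3
mainProg =
  lcpQ (↑r r₀) (↑r (↑r r₀))                                       -- k
  (add (↑r (↑r r₀)) r₀                                            -- i + k
  (add (↑r (↑r (↑r (↑r r₀)))) (↑r r₀)                             -- j + k
  (ifLe (↑r r₀) (↑r (↑r (↑r r₀)))                                 -- i + k ≤ n ?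
    (ifLe r₀ (↑r (↑r (↑r r₀)))                                    -- j + k ≤ n ?
      (ifHole (↑r r₀)                                             -- w_{i+k} a hole?
        (holeProg (↑r (↑r (↑r r₀))) (↑r r₀) r₀ (↑r (↑r r₀)))
        (ifHole r₀                                                -- w_{j+k} a hole?
          (holeProg (↑r (↑r (↑r r₀))) r₀ (↑r r₀) (↑r (↑r r₀)))
          (ret (↑r (↑r r₀)))))
      (ret (↑r (↑r r₀))))
    (ret (↑r (↑r r₀))))))

run-mainProg : {A : Set} (eq : DecidableEquality A) (w : ℕ → Maybe A) (lcpO tabO : ℕ → ℕ → ℕ) →
  ∀ n i j → run eq w lcpO tabO mainProg (n ∷ i ∷ j ∷ []) ≡ lccpFormula w lcpO tabO n i j
run-mainProg eq w lcpO tabO n i j with i + lcpO i j ≤? n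
... | no _ = refl
... | yes _ with j + lcpO i j ≤? n
...   | no _ = refl
...   | yes _ with w (i + lcpO i j)
...     | nothing = run-holeProg eq w lcpO tabO _ _ _ _ (j + lcpO i j ∷ i + lcpO i j ∷ lcpO i j ∷ n ∷ i ∷ j ∷ [])
...     | just _ with w (j + lcpO i j)
...       | nothing = run-holeProg eq w lcpO tabO _ _ _ _ (j + lcpO i j ∷ i + lcpO i j ∷ lcpO i j ∷ n ∷ i ∷ j ∷ [])
...       | just _  = refl

lemma1 : (A : Set) (_≟_ : DecidableEquality A) →
    Σ (Comp 3) λ P →
    (n : ℕ) (w : ℕ → Maybe A) → Sentinel w →
    (lcpO : ℕ → ℕ → ℕ) →
    (∀ i j → 1 ≤ i → i ≤ n → 1 ≤ j → j ≤ n → IsLcp n w i j (lcpO i j)) →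
    (tabO : ℕ → ℕ → ℕ) →
    (∀ i j → 1 ≤ i → i ≤ n → Transit n w j →
    IsLccp n w i j (tabO i j) × IsLccp n w j i (tabO j i)) →
    ∀ i j → 1 ≤ i → i ≤ n → 1 ≤ j → j ≤ n →
    IsLccp n w i j (run _≟_ w lcpO tabO P (n ∷ i ∷ j ∷ []))
lemma1 A _≟_ = mainProg , λ n w sen lcpO lcpH tabO tabH i j 1≤i i≤n 1≤j j≤n →
  subst (IsLccp n w i j) (sym (run-mainProg _≟_ w lcpO tabO n i j))
    (Correctness.lccpFormula-correct n w sen lcpO lcpH tabO tabH i j 1≤i i≤n 1≤j j≤n)
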